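{- Let $n\geq 1$ and let $H\leq W_n$ be a subgroup with $H\cap K_n=\{\mathrm{id}\}$. Then $\pi_n(\Phi(H))=\Phi(\pi_n(H))$.
   Context: $T_n$ is the complete binary rooted tree with $n$ levels and $W_n=\mathrm{Aut}(T_n)$. Restriction to the first $n-1$ levels gives a surjective homomorphism $\pi_n:W_n\to W_{n-1}$, and $K_n=\ker(\pi_n)$. $\Phi(X)$ denotes the Frattini subgroup of a group $X$ (the intersection of all its maximal subgroups). -}

module Defs where

open import Data.Bool using (Bool; true; false; not; _xor_; _∧_; if_then_else_)
open import Data.Unit using (⊤; tt)
open import Data.Product using (Σ; _×_; _,_; ∃; ∃-syntax)
open import Data.Sum using (_⊎_)
open import Data.Nat using (ℕ; zero; suc)
open import Data.List using (List; []; _∷_; concatMap)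
open import Data.Bool.ListAction using (any)
open import Data.Vec using (Vec; []; _∷_)
open import Relation.Binary.PropositionalEquality using (_≡_)

-- W n = Aut(T n), T n the complete binary rooted tree with levels
-- 0 (root), 1, ..., n  (2^n leaves).  An automorphism is given by its
-- portrait: the label at the root (does it swap the two subtrees?) and
-- the sections at the two children.

W : ℕ → Set
W zero    = ⊤
W (suc n) = Bool × W n × W n

child : ∀ {n} → W (suc n) → Bool → W n
child (a , g0 , g1) false = g0
child (a , g0 , g1) true  = g1

act : ∀ {n} → W n → Vec Bool n → Vec Bool n
act {zero}  g []      = []
act {suc n} g (c ∷ x) with g
... | (a , _ , _) = (a xor c) ∷ act (child g c) x

e : ∀ n → W n
e zero    = tt
e (suc n) = false , e n , e n

-- composition:  act (g · h) = act g ∘ act h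
_·_ : ∀ {n} → W n → W n → W n
_·_ {zero}  _ _ = tt
_·_ {suc n} g (b , h0 , h1) with g
... | (a , _ , _) = (a xor b) , (child g b · h0) , (child g (not b) · h1)

inv : ∀ {n} → W n → W n
inv {zero}  _ = tt
inv {suc n} (a , g0 , g1) =
  a , inv (child (a , g0 , g1) a) , inv (child (a , g0 , g1) (not a))

-- π n : restriction to the first n-1 levels (W (suc m) → W m)
π : ∀ {m} → W (suc m) → W m
π {zero}  _            = tt
π {suc m} (a , g0 , g1) = a , π g0 , π g1

eqB : Bool → Bool → Bool
eqB true  b = b
eqB false b = not b

eqW : ∀ {n} → W n → W n → Bool
eqW {zero}  _ _ = true
eqW {suc n} (a , g0 , g1) (b , h0 , h1) = eqB a b ∧ eqW g0 h0 ∧ eqW g1 h1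

allW : ∀ n → List (W n)
allW zero    = tt ∷ []
allW (suc n) =
  concatMap (λ a → concatMap (λ g0 → concatMap (λ g1 → (a , g0 , g1) ∷ [])
    (allW n)) (allW n)) (true ∷ false ∷ [])

-- Subsets of W n (decidable, as W n is finite) and subgroups

Subset : ℕ → Set
Subset n = W n → Bool

_⊆_ : ∀ {n} → Subset n → Subset n → Set
S ⊆ T = ∀ x → S x ≡ true → T x ≡ true

IsSubgroup : ∀ {n} → Subset n → Set
IsSubgroup {n} S =
  (S (e n) ≡ true)
  × (∀ x y → S x ≡ true → S y ≡ true → S (x · y) ≡ true)
  × (∀ x → S x ≡ true → S (inv x) ≡ true)

IsMaximal : ∀ {n} → Subset n → Subset n → Set
IsMaximal H M =
  IsSubgroup M × M ⊆ H × (∃[ x ] (H x ≡ true × M x ≡ false))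
  × (∀ L → IsSubgroup L → M ⊆ L → L ⊆ H → (H ⊆ L) ⊎ (L ⊆ M))

Frattini : ∀ {n} → Subset n → W n → Set
Frattini H x = (H x ≡ true) × (∀ M → IsMaximal H M → M x ≡ true)

image : ∀ {m} → Subset (suc m) → Subset m
image {m} H y = any (λ x → H x ∧ eqW (π x) y) (allW (suc m))

module Submission where

open import Defs
open import Data.Nat using (ℕ; suc; zero)
open import Data.Bool using (Bool; true; false; not; _∧_)
open import Data.Bool.Properties using (∧-conicalˡ; ∧-conicalʳ; ¬-not; T-≡)
open import Data.Bool.ListAction using (any)
open import Data.Unit using (tt)
open import Data.Product using (_×_; ∃-syntax; _,_)
open import Data.Sum using (_⊎_; inj₁; inj₂)
open import Data.List using (List; []; _∷_; concatMap)
open import Data.List.Membership.Propositional using (_∈_; lose)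
open import Data.List.Membership.Propositional.Properties using (∈-concatMap⁺)
open import Data.List.Relation.Unary.Any using (here; there; satisfied)
open import Data.List.Relation.Unary.Any.Properties using (any⁺; any⁻)
open import Function.Bundles using (Equivalence)
open import Relation.Nullary using (contradiction)
open import Relation.Binary.PropositionalEquality
  using (_≡_; refl; sym; trans; cong; cong₂; subst; module ≡-Reasoning)

-- Since H ∩ K = 1, π restricts to an isomorphism H ≅ π(H).  Taking images
-- and taking preimages inside H are then mutually inverse inclusion-preserving
-- bijections between the subgroups of H and of π(H), so they exchange the
-- maximal subgroups, and hence the Frattini subgroups.

open Equivalence using (to; from)

eqB⇒≡ : ∀ a b → eqB a b ≡ true → a ≡ b
eqB⇒≡ true  true  _ = refl
eqB⇒≡ false false _ = refl

eqW⇒≡ : ∀ {n} (x y : W n) → eqW x y ≡ true → x ≡ y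
eqW⇒≡ {zero}  tt tt _ = refl
eqW⇒≡ {suc n} (a , g0 , g1) (b , h0 , h1) p
  with eqB⇒≡ a b (∧-conicalˡ _ _ p)
     | eqW⇒≡ g0 h0 (∧-conicalˡ _ _ (∧-conicalʳ (eqB a b) _ p))
     | eqW⇒≡ g1 h1 (∧-conicalʳ (eqW g0 h0) _ (∧-conicalʳ (eqB a b) _ p))
... | refl | refl | refl = refl

eqW-refl : ∀ {n} (x : W n) → eqW x x ≡ true
eqW-refl {zero}  tt                = refl
eqW-refl {suc n} (true  , g0 , g1) = cong₂ _∧_ (eqW-refl g0) (eqW-refl g1)
eqW-refl {suc n} (false , g0 , g1) = cong₂ _∧_ (eqW-refl g0) (eqW-refl g1)

∈-allW : ∀ {n} (x : W n) → x ∈ allW n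
∈-allW {zero}  tt            = here refl
∈-allW {suc n} (a , g0 , g1) =
  ∈-concatMap⁺ withRoot (lose (∈-bools a)
    (∈-concatMap⁺ (withLeft a) (lose (∈-allW g0)
      (∈-concatMap⁺ (λ g1 → (a , g0 , g1) ∷ []) (lose (∈-allW g1) (here refl))))))
  where
  withLeft : Bool → W n → List (W (suc n))
  withLeft a g0 = concatMap (λ g1 → (a , g0 , g1) ∷ []) (allW n)
  withRoot : Bool → List (W (suc n))
  withRoot a = concatMap (withLeft a) (allW n)
  ∈-bools : ∀ b → b ∈ true ∷ false ∷ []
  ∈-bools true  = here refl
  ∈-bools false = there (here refl)

π-child : ∀ {m} (x : W (suc (suc m))) b → π (child x b) ≡ child (π x) b
π-child (a , g0 , g1) false = refl
π-child (a , g0 , g1) true  = refl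

π-e : ∀ m → π (e (suc m)) ≡ e m
π-e zero    = refl
π-e (suc m) = cong (λ g → false , g , g) (π-e m)

π-· : ∀ {m} (x y : W (suc m)) → π (x · y) ≡ π x · π y
π-· {zero}  x             y             = refl
π-· {suc m} (a , g0 , g1) (b , h0 , h1)
  rewrite π-· (child (a , g0 , g1) b) h0 | π-· (child (a , g0 , g1) (not b)) h1
        | π-child (a , g0 , g1) b | π-child (a , g0 , g1) (not b) = refl

π-inv : ∀ {m} (x : W (suc m)) → π (inv x) ≡ inv (π x)
π-inv {zero}  x                 = refl
π-inv {suc m} (true  , g0 , g1) = cong₂ (λ u v → true  , u , v) (π-inv g1) (π-inv g0)
π-inv {suc m} (false , g0 , g1) = cong₂ (λ u v → false , u , v) (π-inv g0) (π-inv g1)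

inverseˡ : ∀ {n} (x : W n) → inv x · x ≡ e n
inverseˡ {zero}  x                 = refl
inverseˡ {suc n} (true  , g0 , g1) = cong₂ (λ u v → false , u , v) (inverseˡ g0) (inverseˡ g1)
inverseˡ {suc n} (false , g0 , g1) = cong₂ (λ u v → false , u , v) (inverseˡ g0) (inverseˡ g1)

inv·≡e⇒≡ : ∀ {n} (x y : W n) → inv x · y ≡ e n → y ≡ x
inv·≡e⇒≡ {zero}  tt                tt                _ = refl
inv·≡e⇒≡ {suc n} (true  , g0 , g1) (true  , h0 , h1) p
  with inv·≡e⇒≡ g0 h0 (cong (λ z → child z false) p)
     | inv·≡e⇒≡ g1 h1 (cong (λ z → child z true) p)
... | refl | refl = refl
inv·≡e⇒≡ {suc n} (false , g0 , g1) (false , h0 , h1) p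
  with inv·≡e⇒≡ g0 h0 (cong (λ z → child z false) p)
     | inv·≡e⇒≡ g1 h1 (cong (λ z → child z true) p)
... | refl | refl = refl

⊆-trans : ∀ {n} {R S T : Subset n} → R ⊆ S → S ⊆ T → R ⊆ T
⊆-trans R⊆S S⊆T x p = S⊆T x (R⊆S x p)

module _ {m : ℕ} where

  preimageIn : Subset (suc m) → Subset m → Subset (suc m)
  preimageIn H N x = H x ∧ N (π x)

  image⁺ : ∀ (H : Subset (suc m)) x → H x ≡ true → image H (π x) ≡ true
  image⁺ H x hx = to T-≡ (any⁺ _ (lose (∈-allW x) (from T-≡ (cong₂ _∧_ hx (eqW-refl (π x))))))

  image⁻ : ∀ (H : Subset (suc m)) y → image H y ≡ true → ∃[ x ] (H x ≡ true × π x ≡ y)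
  image⁻ H y p with satisfied (any⁻ _ (allW (suc m)) (from T-≡ p))
  ... | x , q = x , ∧-conicalˡ _ _ (to T-≡ q) , eqW⇒≡ (π x) y (∧-conicalʳ (H x) _ (to T-≡ q))

  image-mono : ∀ {L H : Subset (suc m)} → L ⊆ H → image L ⊆ image H
  image-mono {L} {H} L⊆H y p with image⁻ L y p
  ... | x , lx , refl = image⁺ H x (L⊆H x lx)

  preimageIn-mono : ∀ (H : Subset (suc m)) {N N′ : Subset m} → N ⊆ N′ → preimageIn H N ⊆ preimageIn H N′
  preimageIn-mono H N⊆N′ x p = cong₂ _∧_ (∧-conicalˡ _ _ p) (N⊆N′ (π x) (∧-conicalʳ (H x) _ p))

  preimageIn⊆ : ∀ (H : Subset (suc m)) N → preimageIn H N ⊆ H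
  preimageIn⊆ H N x p = ∧-conicalˡ _ _ p

  image-preimageIn⊆ : ∀ (H : Subset (suc m)) N → image (preimageIn H N) ⊆ N
  image-preimageIn⊆ H N y p with image⁻ (preimageIn H N) y p
  ... | x , q , refl = ∧-conicalʳ (H x) _ q

  ⊆-image-preimageIn : ∀ (H : Subset (suc m)) {N} → N ⊆ image H → N ⊆ image (preimageIn H N)
  ⊆-image-preimageIn H {N} N⊆πH y ny with image⁻ H y (N⊆πH y ny)
  ... | x , hx , refl = image⁺ (preimageIn H N) x (cong₂ _∧_ hx ny)

  ⊆-preimageIn-image : ∀ {L H : Subset (suc m)} → L ⊆ H → L ⊆ preimageIn H (image L)
  ⊆-preimageIn-image {L} L⊆H x lx = cong₂ _∧_ (L⊆H x lx) (image⁺ L x lx)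

  image-isSubgroup : ∀ {L : Subset (suc m)} → IsSubgroup L → IsSubgroup (image L)
  image-isSubgroup {L} (eL , ·L , invL) =
    subst (λ y → image L y ≡ true) (π-e m) (image⁺ L _ eL) , closed-· , closed-inv
    where
    closed-· : ∀ y z → image L y ≡ true → image L z ≡ true → image L (y · z) ≡ true
    closed-· y z p q with image⁻ L y p | image⁻ L z q
    ... | x , lx , refl | x′ , lx′ , refl =
      subst (λ w → image L w ≡ true) (π-· x x′) (image⁺ L _ (·L x x′ lx lx′))
    closed-inv : ∀ y → image L y ≡ true → image L (inv y) ≡ true
    closed-inv y p with image⁻ L y p
    ... | x , lx , refl = subst (λ w → image L w ≡ true) (π-inv x) (image⁺ L _ (invL x lx))

  preimageIn-isSubgroup : ∀ {H : Subset (suc m)} {N}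
    → IsSubgroup H → IsSubgroup N → IsSubgroup (preimageIn H N)
  preimageIn-isSubgroup {H} {N} (eH , ·H , invH) (eN , ·N , invN) =
    cong₂ _∧_ eH (trans (cong N (π-e m)) eN)
    , (λ x y p q → cong₂ _∧_ (·H x y (∧-conicalˡ _ _ p) (∧-conicalˡ _ _ q))
         (trans (cong N (π-· x y)) (·N _ _ (∧-conicalʳ (H x) _ p) (∧-conicalʳ (H y) _ q))))
    , (λ x p → cong₂ _∧_ (invH x (∧-conicalˡ _ _ p))
         (trans (cong N (π-inv x)) (invN _ (∧-conicalʳ (H x) _ p))))

module _ (m : ℕ) (H : Subset (suc m)) (H-subgroup : IsSubgroup H)
         (trivial-kernel : ∀ x → H x ≡ true → π x ≡ e m → x ≡ e (suc m)) where

  private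
    ·H : ∀ x y → H x ≡ true → H y ≡ true → H (x · y) ≡ true
    ·H = let (_ , ·H , _) = H-subgroup in ·H
    invH : ∀ x → H x ≡ true → H (inv x) ≡ true
    invH = let (_ , _ , invH) = H-subgroup in invH

  π-injectiveOn : ∀ x y → H x ≡ true → H y ≡ true → π x ≡ π y → x ≡ y
  π-injectiveOn x y hx hy πx≡πy =
    inv·≡e⇒≡ y x (trivial-kernel (inv y · x) (·H _ x (invH y hy) hx) π[y⁻¹x]≡e)
    where
    open ≡-Reasoning
    π[y⁻¹x]≡e : π (inv y · x) ≡ e m
    π[y⁻¹x]≡e = begin
      π (inv y · x)     ≡⟨ π-· (inv y) x ⟩
      π (inv y) · π x   ≡⟨ cong (_· π x) (π-inv y) ⟩
      inv (π y) · π x   ≡⟨ cong (λ z → inv z · π x) (sym πx≡πy) ⟩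
      inv (π x) · π x   ≡⟨ inverseˡ (π x) ⟩
      e m               ∎

  preimageIn-image⊆ : ∀ {L} → L ⊆ H → preimageIn H (image L) ⊆ L
  preimageIn-image⊆ {L} L⊆H x p with image⁻ L (π x) (∧-conicalʳ (H x) _ p)
  ... | x′ , lx′ , πx′≡πx =
    subst (λ z → L z ≡ true) (π-injectiveOn x′ x (L⊆H x′ lx′) (∧-conicalˡ _ _ p) πx′≡πx) lx′

  preimageIn-maximal : ∀ {N} → IsMaximal (image H) N → IsMaximal H (preimageIn H N)
  preimageIn-maximal {N} (N-subgroup , N⊆πH , (y , πHy , Ny≡false) , N-maximal) =
    preimageIn-isSubgroup H-subgroup N-subgroup , preimageIn⊆ H N , witness , maximal
    where
    witness : ∃[ x ] (H x ≡ true × preimageIn H N x ≡ false)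
    witness with image⁻ H y πHy
    ... | x , hx , refl = x , hx , cong₂ _∧_ hx Ny≡false
    maximal : ∀ L → IsSubgroup L → preimageIn H N ⊆ L → L ⊆ H → H ⊆ L ⊎ L ⊆ preimageIn H N
    maximal L L-subgroup N′⊆L L⊆H
      with N-maximal (image L) (image-isSubgroup L-subgroup)
             (⊆-trans (⊆-image-preimageIn H N⊆πH) (image-mono N′⊆L)) (image-mono L⊆H)
    ... | inj₁ πH⊆πL =
      inj₁ (⊆-trans (⊆-preimageIn-image (λ _ p → p))
              (⊆-trans (preimageIn-mono H πH⊆πL) (preimageIn-image⊆ L⊆H)))
    ... | inj₂ πL⊆N = inj₂ (⊆-trans (⊆-preimageIn-image L⊆H) (preimageIn-mono H πL⊆N))

  image-maximal : ∀ {M} → IsMaximal H M → IsMaximal (image H) (image M)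
  image-maximal {M} (M-subgroup , M⊆H , (x , hx , Mx≡false) , M-maximal) =
    image-isSubgroup M-subgroup , image-mono M⊆H , (π x , image⁺ H x hx , witness) , maximal
    where
    witness : image M (π x) ≡ false
    witness = ¬-not λ πMπx →
      contradiction (trans (sym (preimageIn-image⊆ M⊆H x (cong₂ _∧_ hx πMπx))) Mx≡false) λ ()
    maximal : ∀ N → IsSubgroup N → image M ⊆ N → N ⊆ image H → image H ⊆ N ⊎ N ⊆ image M
    maximal N N-subgroup πM⊆N N⊆πH
      with M-maximal (preimageIn H N) (preimageIn-isSubgroup H-subgroup N-subgroup)
             (⊆-trans (⊆-preimageIn-image M⊆H) (preimageIn-mono H πM⊆N)) (preimageIn⊆ H N)
    ... | inj₁ H⊆N′ = inj₁ (⊆-trans (image-mono H⊆N′) (image-preimageIn⊆ H N))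
    ... | inj₂ N′⊆M = inj₂ (⊆-trans (⊆-image-preimageIn H N⊆πH) (image-mono N′⊆M))

  Frattini-image : ∀ x → Frattini H x → Frattini (image H) (π x)
  Frattini-image x (hx , x∈Φ) =
    image⁺ H x hx , λ N N-maximal → ∧-conicalʳ (H x) _ (x∈Φ _ (preimageIn-maximal N-maximal))

  Frattini-lift : ∀ y → Frattini (image H) y → ∃[ x ] (Frattini H x × π x ≡ y)
  Frattini-lift y (πHy , y∈Φ) with image⁻ H y πHy
  ... | x , hx , refl = x , (hx , x∈Φ) , refl
    where
    x∈Φ : ∀ M → IsMaximal H M → M x ≡ true
    x∈Φ M M-maximal@(_ , M⊆H , _) =
      preimageIn-image⊆ M⊆H x (cong₂ _∧_ hx (y∈Φ (image M) (image-maximal M-maximal)))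

lemma4p7 : (m : ℕ) (H : Subset (suc m)) → IsSubgroup H
    → (∀ x → H x ≡ true → π x ≡ e m → x ≡ e (suc m))
    → ∀ y → ((∃[ x ] (Frattini H x × π x ≡ y)) → Frattini (image H) y)
    × (Frattini (image H) y → ∃[ x ] (Frattini H x × π x ≡ y))
lemma4p7 m H H-subgroup trivial-kernel y =
  (λ { (x , x∈Φ , refl) → Frattini-image m H H-subgroup trivial-kernel x x∈Φ })
  , Frattini-lift m H H-subgroup trivial-kernel y
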